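{- If $G$ is a finite group of even order with $d(G)\ge 4$, where $d(G)$ is the minimum size of a generating set of $G$, then $\text{GEN}(G)=*0$.
   Context: For a finite group $G$, $\text{GEN}(G)$ is the impartial game whose positions are the subsets $P\subseteq G$ that either do not generate $G$ (nonterminal) or generate $G$ and contain some $g$ with $\langle P\setminus\{g\}\rangle\neq G$ (terminal). The start is $\emptyset$; the options of a nonterminal $P$ are $P\cup\{g\}$, $g\in G\setminus P$; terminal positions have no options. $\operatorname{nim}(P)=\operatorname{mex}\{\operatorname{nim}(Q): Q\text{ an option of }P\}$, and $\text{GEN}(G)=*n$ means $\operatorname{nim}(\emptyset)=n$. -}

module Defs where

open import Level using (0ℓ)
open import Data.Nat using (ℕ; _<_; _≤_)
open import Data.Fin using (Fin)
open import Data.Fin.Subset using (Subset; _∈_; _∉_; _∪_; ⁅_⁆; _-_; ∣_∣)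
open import Data.Product using (Σ; ∃; _×_)
open import Relation.Binary.PropositionalEquality using (_≡_; _≢_)
open import Relation.Nullary using (¬_)
open import Algebra.Structures using (IsGroup)

-- A finite group of order n, presented (up to isomorphism) on the carrier Fin n,
-- with propositional equality.
record FiniteGroup : Set where
  field
    order : ℕ
    _∙_   : Fin order → Fin order → Fin order
    ε     : Fin order
    _⁻¹   : Fin order → Fin order
    isGroup : IsGroup _≡_ _∙_ ε _⁻¹

module _ (G : FiniteGroup) where
  open FiniteGroup G

  data InSpan (P : Subset order) : Fin order → Set where
    gen : ∀ {x} → x ∈ P → InSpan P x
    one : InSpan P ε
    mul : ∀ {x y} → InSpan P x → InSpan P y → InSpan P (x ∙ y)
    inv : ∀ {x} → InSpan P x → InSpan P (x ⁻¹)

  Generates : Subset order → Set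
  Generates P = ∀ x → InSpan P x

  IsMinGenSize : ℕ → Set
  IsMinGenSize m =
    (∃ λ P → Generates P × ∣ P ∣ ≡ m) × (∀ P → Generates P → m ≤ ∣ P ∣)

  Nonterminal : Subset order → Set
  Nonterminal P = ¬ Generates P

  Terminal : Subset order → Set
  Terminal P = Generates P × ∃ λ g → g ∈ P × ¬ Generates (P - g)

  Option : Subset order → Subset order → Set
  Option P Q = Nonterminal P × ∃ λ g → g ∉ P × Q ≡ P ∪ ⁅ g ⁆

  -- Nim P k : nim(P) = k, i.e. k = mex { nim(Q) : Q an option of P }.
  -- (Inductively defined, hence well-founded; the relation is functional.)
  data Nim : Subset order → ℕ → Set where
    mex : ∀ {P} k →
          (∀ Q → Option P Q → ∃ λ j → Nim Q j × j ≢ k) →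
          (∀ j → j < k → ∃ λ Q → Option P Q × Nim Q j) →
          Nim P k

module Submission where

-- Pairing each element with its inverse shows that a group of even
-- order contains an involution t. The second player answers a move g by a move that generates
-- G whenever one exists, and by g t otherwise, so every position she leaves is closed under
-- right multiplication by t. Once such a position contains some y, hence y t, it generates
-- t = y⁻¹ (y t), so the reply g t adds nothing to g: if no single move completed P ∪ {g} to a
-- generating set, none completes P ∪ {g, g t}. Since d(G) ≥ 4 no single move completes her
-- first reply {g, g t} either, so the first player never generates G and eventually runs out
-- of moves.

open import Defs
open import Level using (Level; 0ℓ)
open import Function using (_∘_)
open import Data.Nat using (ℕ; zero; suc; _+_; _∸_; _≤_; _<_; z≤n; s≤s; allUpTo?)
open import Data.Nat.Properties
  using ( ≤-refl; ≤-trans; ≤-reflexive; ≤-<-trans; <-irrefl; <-cmp; +-suc; +-comm; +-monoʳ-≤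
        ; n≤1+n; m≤n⇒m≤1+n; m<1+n⇒m<n∨m≡n; suc-injective; ∸-monoʳ-< )
open import Data.Nat.Divisibility using (_∣_; divides; ∣m+n∣m⇒∣n; ∣1⇒≡1)
open import Data.Nat.Induction using (<-wellFounded)
open import Data.Fin using (Fin) renaming (_≟_ to _≟ᶠ_)
open import Data.Fin.Properties using (any?; all?)
open import Data.Fin.Subset using (Subset; _∈_; _∉_; _∪_; ⁅_⁆; ∣_∣; ⊥; inside; outside)
open import Data.Fin.Subset.Properties
  using (_∈?_; p⊂q⇒∣p∣<∣q∣; ∣p∣≤n; ∣⊥∣≡0; ∉⊥; x∈p∪q⁺; x∈p∪q⁻; x∈⁅x⁆; x∈⁅y⁆⇒x≡y; ∣⁅x⁆∣≡1)
open import Data.Vec using ([]; _∷_; tabulate)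
open import Data.Vec.Properties using (lookup∘tabulate; []=⇒lookup; lookup⇒[]=)
open import Data.List using (List; []; _∷_; length; filter; map; allFin)
open import Data.List.Extrema.Nat using (max; xs≤max)
open import Data.List.Membership.Propositional using () renaming (_∈_ to _∈ˡ_; _∉_ to _∉ˡ_)
open import Data.List.Membership.DecPropositional Data.Nat._≟_ using () renaming (_∈?_ to _∈ˡ?_)
open import Data.List.Membership.Propositional.Properties
  using (∈-filter⁺; ∈-filter⁻; ∈-map⁺; ∈-map⁻; ∈-allFin)
open import Data.List.Properties using (filter-all; filter-accept; filter-reject; length-tabulate)
open import Data.List.Relation.Unary.All as All using (All)
open import Data.List.Relation.Unary.Any using (here; there)
open import Data.List.Relation.Unary.AllPairs using ([]; _∷_)
open import Data.List.Relation.Unary.Unique.Propositional using (Unique)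
import Data.List.Relation.Unary.Unique.Propositional.Properties as Unique
open import Data.Product using (∃; _×_; _,_; proj₁; proj₂)
open import Data.Sum using (_⊎_; inj₁; inj₂)
open import Data.Empty using (⊥-elim)
open import Data.Bool using (true)
open import Relation.Nullary using (¬_; Dec; yes; no; does; ¬?)
open import Relation.Nullary.Decidable using (_×-dec_; _⊎-dec_; dec-true)
open import Relation.Unary using (Pred; Decidable)
open import Relation.Binary.Definitions using (DecidableEquality; tri<; tri≈; tri>)
open import Relation.Binary.PropositionalEquality
  using (_≡_; _≢_; refl; sym; trans; cong; subst; module ≡-Reasoning)
import Relation.Binary.Construct.On as On
open import Induction.WellFounded using (WellFounded; Acc; acc)
import Induction.WellFounded as WF
open import Algebra.Bundles using (Group)
open import Algebra.Definitions using (Involutive)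
open import Algebra.Structures using (IsGroup)
import Algebra.Properties.Group as GroupProperties

module _ {ℓ : Level} {P : Pred ℕ ℓ} (P? : Decidable P) where

  least-counterexample : ∀ b → ¬ (∀ {j} → j < b → P j) → ∃ λ k → ¬ P k × (∀ {j} → j < k → P j)
  least-counterexample zero ¬below = ⊥-elim (¬below λ ())
  least-counterexample (suc b) ¬below with allUpTo? P? b
  ... | no ¬below′ = least-counterexample b ¬below′
  ... | yes below = b , (λ Pb → ¬below (extend Pb)) , below
    where
      extend : P b → ∀ {j} → j < suc b → P j
      extend Pb j<1+b with m<1+n⇒m<n∨m≡n j<1+b
      ... | inj₁ j<b = below j<b
      ... | inj₂ refl = Pb

mex-exists : (xs : List ℕ) → ∃ λ k → k ∉ˡ xs × (∀ {j} → j < k → j ∈ˡ xs)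
mex-exists xs = least-counterexample (_∈ˡ? xs) (suc (suc (max 0 xs))) beyond-max
  where
    beyond-max : ¬ (∀ {j} → j < suc (suc (max 0 xs)) → j ∈ˡ xs)
    beyond-max below = <-irrefl refl (All.lookup (xs≤max 0 xs) (below ≤-refl))

module Removal {a : Level} {A : Set a} (_≟_ : DecidableEquality A) where

  _without_ : List A → A → List A
  xs without x = filter (λ y → ¬? (y ≟ x)) xs

  without-∉ : ∀ {x} xs → All (x ≢_) xs → xs without x ≡ xs
  without-∉ xs x∉xs = filter-all (λ y → ¬? (y ≟ _)) (All.map (λ x≢y y≡x → x≢y (sym y≡x)) x∉xs)

  length-without : ∀ {x xs} → Unique xs → x ∈ˡ xs → suc (length (xs without x)) ≡ length xs
  length-without {x} {y ∷ ys} (y∉ys ∷ _) (here refl)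
    rewrite filter-reject (λ z → ¬? (z ≟ x)) {y} {ys} (λ y≢y → y≢y refl)
          | without-∉ ys y∉ys = refl
  length-without {x} {y ∷ ys} (y∉ys ∷ ys-unique) (there x∈ys)
    rewrite filter-accept (λ z → ¬? (z ≟ x)) {y} {ys} (All.lookup y∉ys x∈ys)
    = cong suc (length-without ys-unique x∈ys)

  module _ (f : A → A) (f-involutive : Involutive _≡_ f) where

    fixedPointFree-involution⇒2∣length : ∀ xs → Unique xs →
      (∀ {y} → y ∈ˡ xs → f y ∈ˡ xs) → (∀ {y} → y ∈ˡ xs → f y ≢ y) → 2 ∣ length xs
    fixedPointFree-involution⇒2∣length xs = go (length xs) xs refl
      where
      go : ∀ k xs → length xs ≡ k → Unique xs →
           (∀ {y} → y ∈ˡ xs → f y ∈ˡ xs) → (∀ {y} → y ∈ˡ xs → f y ≢ y) → 2 ∣ k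
      go zero xs _ _ _ _ = divides 0 refl
      go (suc zero) (x ∷ []) refl _ closed fixedPointFree with closed (here refl)
      ... | here fx≡x = ⊥-elim (fixedPointFree (here refl) fx≡x)
      go (suc (suc k)) (x ∷ xs) len≡ (x∉xs ∷ xs-unique) closed fixedPointFree
        with go k (xs without f x) length′ (Unique.filter⁺ _ xs-unique) closed′ fixedPointFree′
        where
          fx∈xs : f x ∈ˡ xs
          fx∈xs with closed (here refl)
          ... | here fx≡x = ⊥-elim (fixedPointFree (here refl) fx≡x)
          ... | there fx∈xs = fx∈xs

          length′ : length (xs without f x) ≡ k
          length′ = suc-injective (trans (length-without xs-unique fx∈xs) (suc-injective len≡))

          kept : ∀ {y} → y ∈ˡ xs without f x → y ∈ˡ xs × ¬ (y ≡ f x)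
          kept = ∈-filter⁻ (λ z → ¬? (z ≟ f x)) {xs = xs}

          closed′ : ∀ {y} → y ∈ˡ xs without f x → f y ∈ˡ xs without f x
          closed′ {y} y∈ with kept y∈
          ... | y∈xs , y≢fx with closed (there y∈xs)
          ... | here fy≡x = ⊥-elim (y≢fx (trans (sym (f-involutive y)) (cong f fy≡x)))
          ... | there fy∈xs = ∈-filter⁺ (λ z → ¬? (z ≟ f x)) fy∈xs
            (λ fy≡fx → All.lookup x∉xs y∈xs
              (trans (sym (f-involutive x)) (trans (cong f (sym fy≡fx)) (f-involutive y))))

          fixedPointFree′ : ∀ {y} → y ∈ˡ xs without f x → f y ≢ y
          fixedPointFree′ y∈ = fixedPointFree (there (proj₁ (kept y∈)))
      ... | divides q k≡q*2 = divides (suc q) (cong (λ m → suc (suc m)) k≡q*2)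

module _ {ℓ : Level} {n : ℕ} {P : Pred (Fin n) ℓ} (P? : Decidable P) where

  subset : Subset n
  subset = tabulate (does ∘ P?)

  ∈-subset⁺ : ∀ {x} → P x → x ∈ subset
  ∈-subset⁺ {x} Px =
    lookup⇒[]= x subset (trans (lookup∘tabulate (does ∘ P?) x) (dec-true (P? x) Px))

  ∈-subset⁻ : ∀ {x} → x ∈ subset → P x
  ∈-subset⁻ {x} x∈ = witness (P? x) (trans (sym (lookup∘tabulate (does ∘ P?) x)) ([]=⇒lookup x∈))
    where
      witness : (d : Dec (P x)) → does d ≡ true → P x
      witness (yes Px) _ = Px

∣p∪q∣≤∣p∣+∣q∣ : ∀ {n} (p q : Subset n) → ∣ p ∪ q ∣ ≤ ∣ p ∣ + ∣ q ∣
∣p∪q∣≤∣p∣+∣q∣ [] [] = z≤n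
∣p∪q∣≤∣p∣+∣q∣ (outside ∷ p) (outside ∷ q) = ∣p∪q∣≤∣p∣+∣q∣ p q
∣p∪q∣≤∣p∣+∣q∣ (outside ∷ p) (inside ∷ q) =
  ≤-trans (s≤s (∣p∪q∣≤∣p∣+∣q∣ p q)) (≤-reflexive (sym (+-suc ∣ p ∣ ∣ q ∣)))
∣p∪q∣≤∣p∣+∣q∣ (inside ∷ p) (outside ∷ q) = s≤s (∣p∪q∣≤∣p∣+∣q∣ p q)
∣p∪q∣≤∣p∣+∣q∣ (inside ∷ p) (inside ∷ q) =
  s≤s (≤-trans (∣p∪q∣≤∣p∣+∣q∣ p q) (+-monoʳ-≤ ∣ p ∣ (n≤1+n _)))

∣p∪⁅x⁆∣≤1+∣p∣ : ∀ {n} (p : Subset n) x → ∣ p ∪ ⁅ x ⁆ ∣ ≤ suc ∣ p ∣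
∣p∪⁅x⁆∣≤1+∣p∣ p x = ≤-trans (∣p∪q∣≤∣p∣+∣q∣ p ⁅ x ⁆)
                     (≤-reflexive (trans (cong (∣ p ∣ +_) (∣⁅x⁆∣≡1 x)) (+-comm ∣ p ∣ 1)))

module _ {n : ℕ} {p : Subset n} where

  x∈p⇒x∈p∪⁅y⁆ : ∀ {x y} → x ∈ p → x ∈ p ∪ ⁅ y ⁆
  x∈p⇒x∈p∪⁅y⁆ x∈p = x∈p∪q⁺ (inj₁ x∈p)

  y∈p∪⁅y⁆ : ∀ {y} → y ∈ p ∪ ⁅ y ⁆
  y∈p∪⁅y⁆ {y} = x∈p∪q⁺ (inj₂ (x∈⁅x⁆ y))

  x∈p∪⁅y⁆⁻ : ∀ {x y} → x ∈ p ∪ ⁅ y ⁆ → x ∈ p ⊎ x ≡ y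
  x∈p∪⁅y⁆⁻ {y = y} x∈ with x∈p∪q⁻ p ⁅ y ⁆ x∈
  ... | inj₁ x∈p = inj₁ x∈p
  ... | inj₂ x∈⁅y⁆ = inj₂ (x∈⁅y⁆⇒x≡y y x∈⁅y⁆)

  ∣p∣<∣p∪⁅x⁆∣ : ∀ {x} → x ∉ p → ∣ p ∣ < ∣ p ∪ ⁅ x ⁆ ∣
  ∣p∣<∣p∪⁅x⁆∣ {x} x∉p = p⊂q⇒∣p∣<∣q∣ (x∈p⇒x∈p∪⁅y⁆ , x , y∈p∪⁅y⁆ , x∉p)

module _ (G : FiniteGroup) where
  open FiniteGroup G
  open IsGroup isGroup using (assoc; identityʳ; inverseʳ)

  InSpan-trans : ∀ {A B} → (∀ {z} → z ∈ A → InSpan G B z) → ∀ {x} → InSpan G A x → InSpan G B x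
  InSpan-trans A⊆⟨B⟩ (gen x∈A) = A⊆⟨B⟩ x∈A
  InSpan-trans A⊆⟨B⟩ one = one
  InSpan-trans A⊆⟨B⟩ (mul x y) = mul (InSpan-trans A⊆⟨B⟩ x) (InSpan-trans A⊆⟨B⟩ y)
  InSpan-trans A⊆⟨B⟩ (inv x) = inv (InSpan-trans A⊆⟨B⟩ x)

  -- ⟨P⟩ is the limit of P = D 0 ⊆ D 1 ⊆ …, where D (k + 1) adds to D k all products, inverses
  -- and ε; a strictly growing chain of subsets of G has length at most order.
  module Closure (P : Subset order) where

    Step : Subset order → Fin order → Set
    Step T z = z ∈ T ⊎ (∃ λ x → ∃ λ y → x ∈ T × y ∈ T × z ≡ x ∙ y)
                     ⊎ (∃ λ x → x ∈ T × z ≡ x ⁻¹) ⊎ z ≡ ε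

    step? : ∀ T → Decidable (Step T)
    step? T z = (z ∈? T)
      ⊎-dec any? (λ x → any? (λ y → (x ∈? T) ×-dec (y ∈? T) ×-dec (z ≟ᶠ x ∙ y)))
      ⊎-dec any? (λ x → (x ∈? T) ×-dec (z ≟ᶠ x ⁻¹))
      ⊎-dec (z ≟ᶠ ε)

    D : ℕ → Subset order
    D zero = P
    D (suc k) = subset (step? (D k))

    D⊆⟨P⟩ : ∀ k {z} → z ∈ D k → InSpan G P z
    D⊆⟨P⟩ zero z∈P = gen z∈P
    D⊆⟨P⟩ (suc k) z∈ with ∈-subset⁻ (step? (D k)) z∈
    ... | inj₁ z∈D = D⊆⟨P⟩ k z∈D
    ... | inj₂ (inj₁ (x , y , x∈ , y∈ , refl)) = mul (D⊆⟨P⟩ k x∈) (D⊆⟨P⟩ k y∈)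
    ... | inj₂ (inj₂ (inj₁ (x , x∈ , refl))) = inv (D⊆⟨P⟩ k x∈)
    ... | inj₂ (inj₂ (inj₂ refl)) = one

    D-step : ∀ k {z} → z ∈ D k → z ∈ D (suc k)
    D-step k z∈ = ∈-subset⁺ (step? (D k)) (inj₁ z∈)

    P⊆D : ∀ k {z} → z ∈ P → z ∈ D k
    P⊆D zero z∈P = z∈P
    P⊆D (suc k) z∈P = D-step k (P⊆D k z∈P)

    Grows : ℕ → Set
    Grows k = ∃ λ x → x ∈ D (suc k) × x ∉ D k

    grows? : Decidable Grows
    grows? k = any? (λ x → (x ∈? D (suc k)) ×-dec ¬? (x ∈? D k))

    k≤∣Dk∣ : ∀ k → (∀ {j} → j < k → Grows j) → k ≤ ∣ D k ∣
    k≤∣Dk∣ zero _ = z≤n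
    k≤∣Dk∣ (suc k) grows with grows ≤-refl
    ... | x , x∈ , x∉ =
      ≤-<-trans (k≤∣Dk∣ k (grows ∘ m≤n⇒m≤1+n)) (p⊂q⇒∣p∣<∣q∣ (D-step k , x , x∈ , x∉))

    stops : ∃ λ k → ¬ Grows k
    stops with least-counterexample grows? (suc order)
                 (λ grows → <-irrefl refl (≤-trans (k≤∣Dk∣ (suc order) grows) (∣p∣≤n (D (suc order)))))
    ... | k , ¬grows , _ = k , ¬grows

    K : ℕ
    K = proj₁ stops

    D-closed : ∀ {z} → Step (D K) z → z ∈ D K
    D-closed {z} step with z ∈? D K
    ... | yes z∈ = z∈
    ... | no z∉ = ⊥-elim (proj₂ stops (z , ∈-subset⁺ (step? (D K)) step , z∉))

    ⟨P⟩⊆D : ∀ {z} → InSpan G P z → z ∈ D K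
    ⟨P⟩⊆D (gen z∈P) = P⊆D K z∈P
    ⟨P⟩⊆D one = D-closed (inj₂ (inj₂ (inj₂ refl)))
    ⟨P⟩⊆D (mul {x} {y} x∈ y∈) = D-closed (inj₂ (inj₁ (x , y , ⟨P⟩⊆D x∈ , ⟨P⟩⊆D y∈ , refl)))
    ⟨P⟩⊆D (inv {x} x∈) = D-closed (inj₂ (inj₂ (inj₁ (x , ⟨P⟩⊆D x∈ , refl))))

    InSpan? : Decidable (InSpan G P)
    InSpan? z with z ∈? D K
    ... | yes z∈ = yes (D⊆⟨P⟩ K z∈)
    ... | no z∉ = no (z∉ ∘ ⟨P⟩⊆D)

  Generates? : Decidable (Generates G)
  Generates? P = all? (Closure.InSpan? P)

  group : Group 0ℓ 0ℓ
  group = record { _≈_ = _≡_ ; _∙_ = _∙_ ; ε = ε ; _⁻¹ = _⁻¹ ; isGroup = isGroup }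

  open Removal (_≟ᶠ_ {order}) using (_without_; length-without; fixedPointFree-involution⇒2∣length)
  open GroupProperties group
    using (⁻¹-involutive; ⁻¹-injective; ε⁻¹≈ε; identityʳ-unique; \\-leftDividesʳ)

  involution-exists : 2 ∣ order → ∃ λ t → t ≢ ε × t ∙ t ≡ ε
  involution-exists 2∣order with any? (λ t → ¬? (t ≟ᶠ ε) ×-dec (t ∙ t ≟ᶠ ε))
  ... | yes involution = involution
  ... | no ¬involution = ⊥-elim (2∤1 (∣m+n∣m⇒∣n 2∣length+1 2∣length))
    where
      nonidentity : List (Fin order)
      nonidentity = allFin order without ε
      nonidentity⁻ : ∀ {x} → x ∈ˡ nonidentity → x ≢ ε
      nonidentity⁻ = proj₂ ∘ ∈-filter⁻ (λ z → ¬? (z ≟ᶠ ε)) {xs = allFin order}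

      2∣length : 2 ∣ length nonidentity
      2∣length = fixedPointFree-involution⇒2∣length _⁻¹ ⁻¹-involutive
        nonidentity (Unique.filter⁺ (λ z → ¬? (z ≟ᶠ ε)) (Unique.allFin⁺ order))
        (λ x∈ → ∈-filter⁺ (λ z → ¬? (z ≟ᶠ ε)) (∈-allFin _)
                  (λ x⁻¹≡ε → nonidentity⁻ x∈ (⁻¹-injective (trans x⁻¹≡ε (sym ε⁻¹≈ε)))))
        (λ {x} x∈ x⁻¹≡x →
          ¬involution (x , nonidentity⁻ x∈ , trans (cong (x ∙_) (sym x⁻¹≡x)) (inverseʳ x)))

      2∣length+1 : 2 ∣ length nonidentity + 1
      2∣length+1 = subst (2 ∣_) (begin
        order                      ≡⟨ sym (length-tabulate {n = order} (λ x → x)) ⟩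
        length (allFin order)      ≡⟨ sym (length-without (Unique.allFin⁺ order) (∈-allFin ε)) ⟩
        1 + length nonidentity     ≡⟨ +-comm 1 _ ⟩
        length nonidentity + 1     ∎) 2∣order
        where open ≡-Reasoning

      2∤1 : ¬ (2 ∣ 1)
      2∤1 2∣1 with ∣1⇒≡1 2∣1
      ... | ()

  _⊏_ : Subset order → Subset order → Set
  Q ⊏ P = Option G P Q

  ⊏-wellFounded : WellFounded _⊏_
  ⊏-wellFounded = WF.Subrelation.wellFounded shrinks (On.wellFounded gap <-wellFounded)
    where
      gap : Subset order → ℕ
      gap P = order ∸ ∣ P ∣

      shrinks : ∀ {Q P} → Q ⊏ P → gap Q < gap P
      shrinks {P = P} (_ , g , g∉P , refl) = ∸-monoʳ-< (∣p∣<∣p∪⁅x⁆∣ g∉P) (∣p∣≤n (P ∪ ⁅ g ⁆))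

  generates⇒nim0 : ∀ {P} → Generates G P → Nim G P 0
  generates⇒nim0 ⟨P⟩=G = mex 0 (λ _ (¬⟨P⟩=G , _) → ⊥-elim (¬⟨P⟩=G ⟨P⟩=G)) (λ _ ())

  nim-from-options : ∀ {P} → Nonterminal G P → (∀ g → g ∉ P → ∃ (Nim G (P ∪ ⁅ g ⁆))) → ∃ (Nim G P)
  nim-from-options {P} ¬⟨P⟩=G option-nim = k , mex k options-avoid-k options-reach-below-k
    where
      -- the value 0 for g ∈ P is junk
      nim-after : ∀ g → ∃ λ j → g ∉ P → Nim G (P ∪ ⁅ g ⁆) j
      nim-after g with g ∈? P
      ... | yes g∈P = 0 , λ g∉P → ⊥-elim (g∉P g∈P)
      ... | no g∉P = proj₁ (option-nim g g∉P) , λ _ → proj₂ (option-nim g g∉P)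

      moves : List (Fin order)
      moves = filter (λ g → ¬? (g ∈? P)) (allFin order)

      values : List ℕ
      values = map (proj₁ ∘ nim-after) moves

      k : ℕ
      k = proj₁ (mex-exists values)

      options-avoid-k : ∀ Q → Option G P Q → ∃ λ j → Nim G Q j × j ≢ k
      options-avoid-k _ (_ , g , g∉P , refl) = proj₁ (nim-after g) , proj₂ (nim-after g) g∉P ,
        λ j≡k → proj₁ (proj₂ (mex-exists values))
                  (subst (_∈ˡ values) j≡k (∈-map⁺ _ (∈-filter⁺ (λ g → ¬? (g ∈? P)) (∈-allFin g) g∉P)))

      options-reach-below-k : ∀ j → j < k → ∃ λ Q → Option G P Q × Nim G Q j
      options-reach-below-k j j<k with ∈-map⁻ _ (proj₂ (proj₂ (mex-exists values)) j<k)
      ... | g , g∈moves , refl = P ∪ ⁅ g ⁆ , (¬⟨P⟩=G , g , g∉P , refl) , proj₂ (nim-after g) g∉P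
        where
          g∉P : g ∉ P
          g∉P = proj₂ (∈-filter⁻ (λ g → ¬? (g ∈? P)) {xs = allFin order} g∈moves)

  nim-exists : ∀ P → ∃ (Nim G P)
  nim-exists P = go P (⊏-wellFounded P)
    where
      go : ∀ P → Acc _⊏_ P → ∃ (Nim G P)
      go P (acc rs) with Generates? P
      ... | yes ⟨P⟩=G = 0 , generates⇒nim0 ⟨P⟩=G
      ... | no ¬⟨P⟩=G = nim-from-options ¬⟨P⟩=G (λ g g∉P → go _ (rs (¬⟨P⟩=G , g , g∉P , refl)))

  nim-functional : ∀ {P j k} → Nim G P j → Nim G P k → j ≡ k
  nim≮ : ∀ {P j k} → Nim G P j → Nim G P k → ¬ (j < k)

  nim-functional {j = j} {k} nim-j nim-k with <-cmp j k
  ... | tri< j<k _ _ = ⊥-elim (nim≮ nim-j nim-k j<k)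
  ... | tri≈ _ j≡k _ = j≡k
  ... | tri> _ _ k<j = ⊥-elim (nim≮ nim-k nim-j k<j)

  nim≮ (mex _ avoid-j _) (mex _ _ reach-k) j<k with reach-k _ j<k
  ... | Q , Q-option , Q-nim with avoid-j Q Q-option
  ...   | i , Q-nim′ , i≢j = i≢j (nim-functional Q-nim′ Q-nim)

  nim≢0-if-option-nim0 : ∀ {Q R j} → Nim G Q j → Option G Q R → Nim G R 0 → j ≢ 0
  nim≢0-if-option-nim0 (mex _ avoid _) R-option R-nim refl with avoid _ R-option
  ... | i , R-nim′ , i≢0 = i≢0 (nim-functional R-nim′ R-nim)

  nim0-if-every-option-has-option-nim0 : ∀ {P} →
    (∀ Q → Option G P Q → ∃ λ R → Option G Q R × Nim G R 0) → Nim G P 0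
  nim0-if-every-option-has-option-nim0 reply = mex 0 options-nonzero (λ _ ())
    where
      options-nonzero : ∀ Q → Option G _ Q → ∃ λ j → Nim G Q j × j ≢ 0
      options-nonzero Q Q-option with nim-exists Q | reply Q Q-option
      ... | j , Q-nim | R , R-option , R-nim = j , Q-nim , nim≢0-if-option-nim0 Q-nim R-option R-nim

  generates-from : ∀ {A B} → (∀ {z} → z ∈ A → InSpan G B z) → Generates G A → Generates G B
  generates-from A⊆⟨B⟩ ⟨A⟩=G z = InSpan-trans A⊆⟨B⟩ (⟨A⟩=G z)

  generates-∪⁅x⁆⇒generates : ∀ {P x} → x ∈ P → Generates G (P ∪ ⁅ x ⁆) → Generates G P
  generates-∪⁅x⁆⇒generates {P} {x} x∈P = generates-from (λ z∈ → gen (absorb (x∈p∪⁅y⁆⁻ z∈)))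
    where
      absorb : ∀ {z} → z ∈ P ⊎ z ≡ x → z ∈ P
      absorb (inj₁ z∈P) = z∈P
      absorb (inj₂ refl) = x∈P

  module SecondPlayer (t : Fin order) (t≢ε : t ≢ ε) (t∙t≡ε : t ∙ t ≡ ε)
                      (generators-≥4 : ∀ T → Generates G T → 4 ≤ ∣ T ∣) where

    Closed : Subset order → Set
    Closed P = ∀ {x} → x ∈ P → x ∙ t ∈ P

    record Safe (P : Subset order) : Set where
      field
        closed : Closed P
        inhabited : ∃ (_∈ P)
        no-winning-move : ∀ x → ¬ Generates G (P ∪ ⁅ x ⁆)

    x∙t∙t≡x : ∀ x → (x ∙ t) ∙ t ≡ x
    x∙t∙t≡x x = trans (assoc x t t) (trans (cong (x ∙_) t∙t≡ε) (identityʳ x))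

    closed-∪-pair : ∀ {P} g → Closed P → Closed ((P ∪ ⁅ g ⁆) ∪ ⁅ g ∙ t ⁆)
    closed-∪-pair {P} g closed x∈ with x∈p∪⁅y⁆⁻ x∈
    ... | inj₂ refl = x∈p⇒x∈p∪⁅y⁆ (subst (_∈ P ∪ ⁅ g ⁆) (sym (x∙t∙t≡x g)) y∈p∪⁅y⁆)
    ... | inj₁ x∈ with x∈p∪⁅y⁆⁻ x∈
    ...   | inj₁ x∈P = x∈p⇒x∈p∪⁅y⁆ (x∈p⇒x∈p∪⁅y⁆ (closed x∈P))
    ...   | inj₂ refl = y∈p∪⁅y⁆

    g∙t-fresh : ∀ {P} g → Closed P → g ∉ P → g ∙ t ∉ P ∪ ⁅ g ⁆
    g∙t-fresh {P} g closed g∉P g∙t∈ with x∈p∪⁅y⁆⁻ g∙t∈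
    ... | inj₁ g∙t∈P = g∉P (subst (_∈ P) (x∙t∙t≡x g) (closed g∙t∈P))
    ... | inj₂ g∙t≡g = t≢ε (identityʳ-unique g t g∙t≡g)

    reply-redundant : ∀ {P g x} → Safe P → Generates G (((P ∪ ⁅ g ⁆) ∪ ⁅ g ∙ t ⁆) ∪ ⁅ x ⁆) →
                      Generates G ((P ∪ ⁅ g ⁆) ∪ ⁅ x ⁆)
    reply-redundant {P} {g} {x} safe = generates-from (λ z∈ → recover (x∈p∪⁅y⁆⁻ z∈))
      where
        open Safe safe
        y : Fin order
        y = proj₁ inhabited
        y∈P : y ∈ P
        y∈P = proj₂ inhabited
        Q : Subset order
        Q = (P ∪ ⁅ g ⁆) ∪ ⁅ x ⁆
        ⟨P⟩⊆⟨Q⟩ : ∀ {z} → z ∈ P → InSpan G Q z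
        ⟨P⟩⊆⟨Q⟩ z∈P = gen (x∈p⇒x∈p∪⁅y⁆ (x∈p⇒x∈p∪⁅y⁆ z∈P))
        recover : ∀ {z} → z ∈ (P ∪ ⁅ g ⁆) ∪ ⁅ g ∙ t ⁆ ⊎ z ≡ x → InSpan G Q z
        recover (inj₂ refl) = gen y∈p∪⁅y⁆
        recover (inj₁ z∈) with x∈p∪⁅y⁆⁻ z∈
        ... | inj₁ z∈P∪g = gen (x∈p⇒x∈p∪⁅y⁆ z∈P∪g)
        ... | inj₂ refl = mul (gen (x∈p⇒x∈p∪⁅y⁆ y∈p∪⁅y⁆))
                            (subst (InSpan G Q) (\\-leftDividesʳ y t)
                              (mul (inv (⟨P⟩⊆⟨Q⟩ y∈P)) (⟨P⟩⊆⟨Q⟩ (closed y∈P))))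

    safe⇒nim0 : ∀ P → Acc _⊏_ P → Safe P → Nim G P 0
    reply : ∀ {P Q} → Safe P → Option G P Q → Acc _⊏_ Q → ∃ λ R → Option G Q R × Nim G R 0

    safe⇒nim0 P (acc rs) safe =
      nim0-if-every-option-has-option-nim0 λ _ Q-option → reply safe Q-option (rs Q-option)

    reply {P} safe (_ , g , g∉P , refl) (acc rs) with any? (λ x → Generates? ((P ∪ ⁅ g ⁆) ∪ ⁅ x ⁆))
    ... | yes (x , ⟨Q∪x⟩=G) =
      (P ∪ ⁅ g ⁆) ∪ ⁅ x ⁆ , (no-winning-move g , x , x∉Q , refl) , generates⇒nim0 ⟨Q∪x⟩=G
      where
        open Safe safe
        x∉Q : x ∉ P ∪ ⁅ g ⁆
        x∉Q x∈Q = no-winning-move g (generates-∪⁅x⁆⇒generates x∈Q ⟨Q∪x⟩=G)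
    ... | no ¬win = R , R-option , safe⇒nim0 R (rs R-option) R-safe
      where
        open Safe safe
        R : Subset order
        R = (P ∪ ⁅ g ⁆) ∪ ⁅ g ∙ t ⁆
        R-option : Option G (P ∪ ⁅ g ⁆) R
        R-option = no-winning-move g , g ∙ t , g∙t-fresh g closed g∉P , refl
        R-safe : Safe R
        R-safe = record
          { closed = closed-∪-pair g closed
          ; inhabited = g , x∈p⇒x∈p∪⁅y⁆ y∈p∪⁅y⁆
          ; no-winning-move = λ x ⟨R∪x⟩=G → ¬win (x , reply-redundant safe ⟨R∪x⟩=G)
          }

    ¬generates-if-∣∣≤3 : ∀ T → ∣ T ∣ ≤ 3 → ¬ Generates G T
    ¬generates-if-∣∣≤3 T ∣T∣≤3 ⟨T⟩=G = <-irrefl refl (≤-trans (generators-≥4 T ⟨T⟩=G) ∣T∣≤3)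

    nim⊥≡0 : Nim G ⊥ 0
    nim⊥≡0 = nim0-if-every-option-has-option-nim0 λ { _ (_ , g , _ , refl) → first-reply g }
      where
        first-reply : ∀ g → ∃ λ R → Option G (⊥ ∪ ⁅ g ⁆) R × Nim G R 0
        first-reply g = R , R-option , safe⇒nim0 R (⊏-wellFounded R) R-safe
          where
            R : Subset order
            R = (⊥ ∪ ⁅ g ⁆) ∪ ⁅ g ∙ t ⁆
            ∣⁅g⁆∣≤1 : ∣ ⊥ ∪ ⁅ g ⁆ ∣ ≤ 1
            ∣⁅g⁆∣≤1 = ≤-trans (∣p∪⁅x⁆∣≤1+∣p∣ ⊥ g) (s≤s (≤-reflexive (∣⊥∣≡0 order)))
            ∣R∣≤2 : ∣ R ∣ ≤ 2
            ∣R∣≤2 = ≤-trans (∣p∪⁅x⁆∣≤1+∣p∣ (⊥ ∪ ⁅ g ⁆) (g ∙ t)) (s≤s ∣⁅g⁆∣≤1)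
            closed⊥ : Closed ⊥
            closed⊥ x∈⊥ = ⊥-elim (∉⊥ x∈⊥)
            R-option : Option G (⊥ ∪ ⁅ g ⁆) R
            R-option =
              ¬generates-if-∣∣≤3 _ (≤-trans ∣⁅g⁆∣≤1 (s≤s z≤n)) , g ∙ t , g∙t-fresh g closed⊥ ∉⊥ , refl
            R-safe : Safe R
            R-safe = record
              { closed = closed-∪-pair g closed⊥
              ; inhabited = g , x∈p⇒x∈p∪⁅y⁆ y∈p∪⁅y⁆
              ; no-winning-move = λ x →
                  ¬generates-if-∣∣≤3 _ (≤-trans (∣p∪⁅x⁆∣≤1+∣p∣ R x) (s≤s ∣R∣≤2))
              }

corollary3p11 : (G : FiniteGroup) → 2 ∣ FiniteGroup.order G → (d : ℕ) → IsMinGenSize G d → 4 ≤ d → Nim G ⊥ 0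
corollary3p11 G 2∣order d (_ , d-minimal) 4≤d with involution-exists G 2∣order
... | t , t≢ε , t∙t≡ε =
  SecondPlayer.nim⊥≡0 G t t≢ε t∙t≡ε (λ T ⟨T⟩=G → ≤-trans 4≤d (d-minimal T ⟨T⟩=G))
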